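{- Let $k\geq 2$, $n\geq 0$, let $\lambda\in\mathcal{O}_k(n)$, and let $i$ be a part of $\lambda$ with multiplicity $m_i\geq 1$. Then \[ \left|\mathcal{O}_{\lambda,k,i}\right|=\frac{m_i-p(m_i)}{k-1}. \]
   Context: A partition of $n$ is a finite nonincreasing sequence of positive integers summing to $n$. $\mathcal{O}_k(n)$ is the set of partitions of $n$ with no part divisible by $k$. For a positive integer $m$ with base-$k$ expansion $m=b_1k^{a_1}+\cdots+b_pk^{a_p}$ ($a_1>\cdots>a_p\geq 0$, $1\leq b_j\leq k-1$), let $p(m)=b_1+\cdots+b_p$ and $a(m)=a_1$. For $\lambda\in\mathcal{O}_k(n)$ and a part $i$ of $\lambda$ of multiplicity $m_i$, for integers $1\leq j\leq a(m_i)$ and $1\leq r\leq\lfloor m_i/k^j\rfloor$ let $\pi^i_{j,r}$ be the partition obtained from $\lambda$ by replacing $r\cdot k^j$ of the parts equal to $i$ by $r$ parts equal to $i\cdot k^j$. Define $\mathcal{O}_{\lambda,k,i}=\{\pi^i_{j,r}:1\leq j\leq a(m_i),\ 1\leq r\leq\lfloor m_i/k^j\rfloor\}$ (empty if $m_i<k$). -}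

module Defs where

open import Data.Nat using (ℕ; zero; suc; _+_; _*_; _∸_; _^_; _≤_; _<_; _≤?_; _≟_)
open import Data.Nat.DivMod using (_/_; _%_)
open import Data.Nat.Divisibility using (_∣_)
open import Data.List using (List; []; _∷_; _++_; length; replicate; map; concatMap; applyUpTo; filter; deduplicate)
open import Data.List.Properties using (≡-dec)
open import Data.Nat.ListAction using (sum)
open import Data.List.Relation.Unary.All using (All)
open import Data.List.Relation.Unary.Linked using (Linked)
open import Data.Product using (_×_)
open import Relation.Nullary using (¬_; yes; no)
open import Relation.Binary.PropositionalEquality using (_≡_)

IsPartition : ℕ → List ℕ → Set
IsPartition n xs = Linked (λ a b → b ≤ a) xs × All (λ a → 0 < a) xs × sum xs ≡ n

InO : ℕ → ℕ → List ℕ → Set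
InO k n xs = IsPartition n xs × All (λ a → ¬ (k ∣ a)) xs

mult : ℕ → List ℕ → ℕ
mult i [] = 0
mult i (x ∷ xs) with x ≟ i
... | yes _ = suc (mult i xs)
... | no _  = mult i xs

digitsF : ℕ → ℕ → ℕ → List ℕ
digitsF zero    _        _       = []
digitsF (suc k) zero     _       = []
digitsF (suc k) (suc f)  zero    = []
digitsF (suc k) (suc f)  (suc m) = (suc m % suc k) ∷ digitsF (suc k) f (suc m / suc k)

digits : ℕ → ℕ → List ℕ
digits k m = digitsF k m m

pk : ℕ → ℕ → ℕ
pk k m = sum (digits k m)

-- a(m): the leading exponent of the base-k expansion of m (m ≥ 1)
ak : ℕ → ℕ → ℕ
ak k m = length (digits k m) ∸ 1

removeN : ℕ → ℕ → List ℕ → List ℕ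
removeN zero    i xs       = xs
removeN (suc c) i []       = []
removeN (suc c) i (x ∷ xs) with x ≟ i
... | yes _ = removeN c i xs
... | no _  = x ∷ removeN (suc c) i xs

insertDesc : ℕ → List ℕ → List ℕ
insertDesc x [] = x ∷ []
insertDesc x (y ∷ ys) with y ≤? x
... | yes _ = x ∷ y ∷ ys
... | no _  = y ∷ insertDesc x ys

sortDesc : List ℕ → List ℕ
sortDesc [] = []
sortDesc (x ∷ xs) = insertDesc x (sortDesc xs)

-- π^i_{j,r}: replace r·k^j parts equal to i by r parts equal to i·k^j
piPart : ℕ → List ℕ → ℕ → ℕ → ℕ → List ℕ
piPart k lam i j r = sortDesc (replicate r (i * k ^ j) ++ removeN (r * k ^ j) i lam)

range : ℕ → ℕ → List ℕ
range a b = applyUpTo (λ t → a + t) (suc b ∸ a)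

piList : ℕ → List ℕ → ℕ → List (List ℕ)
piList k lam i =
  concatMap (λ j → map (piPart k lam i j)
                       (filter (λ r → r * k ^ j ≤? mult i lam) (range 1 (mult i lam))))
            (range 1 (ak k (mult i lam)))

-- the set 𝒪_{λ,k,i} as a duplicate-free list (partitions as sorted lists)
Oset : ℕ → List ℕ → ℕ → List (List ℕ)
Oset k lam i = deduplicate (≡-dec _≟_) (piList k lam i)

{-# OPTIONS --safe #-}
-- Write m for the multiplicity of i.  The parts of π^i_{j,r} divisible by k are exactly r copies
-- of i·k^j, since no part of λ is divisible by k; this determines r and, as i > 0 and k > 1, also j.
-- So the π^i_{j,r} are pairwise distinct and |𝒪_{λ,k,i}| = Σ_{j=1}^{a(m)} ⌊m/k^j⌋.  Finally
-- (k − 1) Σ_{j ≥ 1} ⌊m/k^j⌋ = m − p(m) (Legendre), by peeling off the last digit: m = m % k + k⌊m/k⌋.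
module Submission where

open import Defs
open import Data.Nat using (ℕ; zero; suc; _*_; _+_; _∸_; _^_; _≤_; _<_; _≤?_; NonZero; >-nonZero; z<s; s≤s; s≤s⁻¹)
open import Data.Nat.Properties
open import Data.Nat.DivMod using (_/_; _%_; m≡m%n+[m/n]*n; m/n<m; m*n/n≡m; /-monoˡ-≤; m/n*n≤m; m/n≤m; m/n/o≡m/[n*o]; n/1≡n)
open import Data.Nat.Divisibility using (_∣_; _∣?_; ∣-trans; m∣m*n; n∣m*n)
open import Data.Nat.ListAction using (sum)
open import Data.Nat.Tactic.RingSolver using (solve-∀)
open import Data.List using (List; []; _∷_; _++_; [_]; length; replicate; map; concatMap; applyUpTo; filter; deduplicate)
open import Data.List.Properties
  using (≡-dec; length-++; length-map; length-replicate; length-applyUpTo; map-∘; map-cong; map-applyUpTo;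
         applyUpTo-∷ʳ; filter-all; filter-none; filter-reject; filter-++; ++-identityʳ)
open import Data.List.Membership.Propositional using (_∈_)
open import Data.List.Membership.Propositional.Properties using (∈-map⁻; ∈-filter⁻; ∈-applyUpTo⁻)
open import Data.List.Relation.Unary.All as All using (All; []; _∷_)
import Data.List.Relation.Unary.All.Properties as All
open import Data.List.Relation.Unary.Any using (here)
open import Data.List.Relation.Unary.AllPairs using ([]; _∷_)
import Data.List.Relation.Unary.AllPairs.Properties as AllPairs
open import Data.List.Relation.Unary.Unique.Propositional using (Unique)
import Data.List.Relation.Unary.Unique.Propositional.Properties as Unique
open import Data.List.Relation.Binary.Disjoint.Propositional using (Disjoint)
open import Data.List.Relation.Binary.Permutation.Propositional
  using (_↭_; prep; swap; ↭-refl; ↭-reflexive; ↭-sym; ↭-trans)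
open import Data.List.Relation.Binary.Permutation.Propositional.Properties using (↭-length; ∈-resp-↭; filter-↭)
open import Data.Product using (_,_; proj₁)
open import Data.Sum using (inj₁; inj₂)
open import Data.Empty using (⊥-elim)
open import Function using (_∘_)
open import Level using (Level)
open import Relation.Nullary using (¬_; yes; no)
open import Relation.Unary using (Pred; Decidable)
open import Relation.Binary.Definitions using (DecidableEquality; tri<; tri≈; tri>)
open import Relation.Binary.PropositionalEquality
  using (_≡_; refl; sym; trans; cong; cong₂; subst; module ≡-Reasoning)

private
  variable
    a p : Level
    A : Set a

deduplicate-unique : (_≟_ : DecidableEquality A) {xs : List A} → Unique xs → deduplicate _≟_ xs ≡ xs
deduplicate-unique _≟_ {[]} [] = refl
deduplicate-unique _≟_ {x ∷ xs} (x∉xs ∷ xs!) rewrite deduplicate-unique _≟_ xs! = cong (x ∷_) (filter-all _ x∉xs)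

length-concatMap : ∀ {B : Set} (f : A → List B) xs → length (concatMap f xs) ≡ sum (map (λ x → length (f x)) xs)
length-concatMap f [] = refl
length-concatMap f (x ∷ xs) = trans (length-++ (f x)) (cong (length (f x) +_) (length-concatMap f xs))

length-filter-applyUpTo-suc : {P : Pred ℕ p} (P? : Decidable P) {Q : ℕ} →
  (∀ {r} → P r → r ≤ Q) → (∀ {r} → r ≤ Q → P r) →
  ∀ {N} → Q ≤ N → length (filter P? (applyUpTo suc N)) ≡ Q
length-filter-applyUpTo-suc P? to from {zero} Q≤0 = sym (n≤0⇒n≡0 Q≤0)
length-filter-applyUpTo-suc P? {Q} to from {suc N} Q≤1+N with m≤n⇒m<n∨m≡n Q≤1+N
... | inj₂ refl = trans (cong length (filter-all P? (All.applyUpTo⁺₁ suc (suc N) from))) (length-applyUpTo suc (suc N))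
... | inj₁ (s≤s Q≤N) = begin
  length (filter P? (applyUpTo suc (suc N)))                  ≡⟨ cong (length ∘ filter P?) (applyUpTo-∷ʳ suc N) ⟨
  length (filter P? (applyUpTo suc N ++ [ suc N ]))           ≡⟨ cong length (filter-++ P? (applyUpTo suc N) [ suc N ]) ⟩
  length (filter P? (applyUpTo suc N) ++ filter P? [ suc N ]) ≡⟨ cong (λ ys → length (filter P? (applyUpTo suc N) ++ ys)) ¬P[1+N] ⟩
  length (filter P? (applyUpTo suc N) ++ [])                  ≡⟨ cong length (++-identityʳ (filter P? (applyUpTo suc N))) ⟩
  length (filter P? (applyUpTo suc N))                        ≡⟨ length-filter-applyUpTo-suc P? to from Q≤N ⟩
  Q                                                           ∎
  where
  open ≡-Reasoning
  ¬P[1+N] : filter P? [ suc N ] ≡ []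
  ¬P[1+N] = filter-reject P? (λ P[1+N] → 1+n≰n (≤-trans (to P[1+N]) Q≤N))

applyUpTo-suc-unique : ∀ n → Unique (applyUpTo suc n)
applyUpTo-suc-unique n = Unique.applyUpTo⁺₁ suc n (λ i<j _ → <⇒≢ i<j ∘ suc-injective)

All-removeN : {P : Pred ℕ p} → ∀ c i {xs} → All P xs → All P (removeN c i xs)
All-removeN zero    i          Pxs        = Pxs
All-removeN (suc c) i {[]}     Pxs        = Pxs
All-removeN (suc c) i {x ∷ xs} (Px ∷ Pxs) with x ≟ i
... | yes _ = All-removeN c i Pxs
... | no  _ = Px ∷ All-removeN (suc c) i Pxs

insertDesc-↭ : ∀ x ys → insertDesc x ys ↭ x ∷ ys
insertDesc-↭ x [] = ↭-refl
insertDesc-↭ x (y ∷ ys) with y ≤? x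
... | yes _ = ↭-refl
... | no  _ = ↭-trans (prep y (insertDesc-↭ x ys)) (swap y x ↭-refl)

sortDesc-↭ : ∀ xs → sortDesc xs ↭ xs
sortDesc-↭ [] = ↭-refl
sortDesc-↭ (x ∷ xs) = ↭-trans (insertDesc-↭ x (sortDesc xs)) (prep x (sortDesc-↭ xs))

*≤⇒≤/ : ∀ r m n .{{_ : NonZero n}} → r * n ≤ m → r ≤ m / n
*≤⇒≤/ r m n rn≤m = ≤-trans (≤-reflexive (sym (m*n/n≡m r n))) (/-monoˡ-≤ n rn≤m)

≤/⇒*≤ : ∀ r m n .{{_ : NonZero n}} → r ≤ m / n → r * n ≤ m
≤/⇒*≤ r m n r≤m/n = ≤-trans (*-monoˡ-≤ n r≤m/n) (m/n*n≤m m n)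

-- Instance search cannot find NonZero (k ^ t) by itself.
⌊_/_^_⌋ : ℕ → ∀ k .{{_ : NonZero k}} → ℕ → ℕ
⌊ m / k ^ t ⌋ = (m / k ^ t) {{m^n≢0 k t}}

⌊/^⌋-suc : ∀ m k .{{k≢0 : NonZero k}} t → ⌊ m / k ^ suc t ⌋ ≡ ⌊ (m / k) / k ^ t ⌋
⌊/^⌋-suc m k {{k≢0}} t = sym (m/n/o≡m/[n*o] m k (k ^ t) {{k≢0}} {{m^n≢0 k t}} {{m^n≢0 k (suc t)}})

^-injectiveʳ : ∀ {k} → 1 < k → ∀ {a b} → k ^ a ≡ k ^ b → a ≡ b
^-injectiveʳ {k} 1<k {a} {b} kᵃ≡kᵇ with <-cmp a b
... | tri< a<b _ _ = ⊥-elim (<⇒≢ (^-monoʳ-< k 1<k a<b) kᵃ≡kᵇ)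
... | tri≈ _ a≡b _ = a≡b
... | tri> _ _ b<a = ⊥-elim (<⇒≢ (^-monoʳ-< k 1<k b<a) (sym kᵃ≡kᵇ))

quotientSum : ∀ k .{{_ : NonZero k}} → ℕ → ℕ → ℕ
quotientSum k m A = sum (map (λ t → ⌊ m / k ^ t ⌋) (applyUpTo suc A))

quotientSum-suc : ∀ k .{{_ : NonZero k}} m A → quotientSum k m (suc A) ≡ m / k + quotientSum k (m / k) A
quotientSum-suc k m A = cong₂ _+_ (trans (⌊/^⌋-suc m k 0) (n/1≡n (m / k))) (cong sum (begin
  map (λ t → ⌊ m / k ^ t ⌋) (applyUpTo (suc ∘ suc) A)   ≡⟨ cong (map (λ t → ⌊ m / k ^ t ⌋)) (map-applyUpTo suc suc A) ⟨
  map (λ t → ⌊ m / k ^ t ⌋) (map suc (applyUpTo suc A)) ≡⟨ map-∘ (applyUpTo suc A) ⟨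
  map (λ t → ⌊ m / k ^ suc t ⌋) (applyUpTo suc A)       ≡⟨ map-cong (⌊/^⌋-suc m k) (applyUpTo suc A) ⟩
  map (λ t → ⌊ (m / k) / k ^ t ⌋) (applyUpTo suc A)     ∎))
  where open ≡-Reasoning

digitsF-zero : ∀ k f → digitsF k f 0 ≡ []
digitsF-zero zero    f       = refl
digitsF-zero (suc k) zero    = refl
digitsF-zero (suc k) (suc f) = refl

digitsF-suc : ∀ k .{{_ : NonZero k}} f m → digitsF k (suc f) (suc m) ≡ suc m % k ∷ digitsF k f (suc m / k)
digitsF-suc (suc k) f m = refl

module _ {k : ℕ} {lam : List ℕ} {i : ℕ} (lam-indivisible : All (λ a → ¬ k ∣ a) lam) where

  filter-∣-piPart : ∀ j r → filter (k ∣?_) (piPart k lam i (suc j) r) ↭ replicate r (i * k ^ suc j)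
  filter-∣-piPart j r = ↭-trans (filter-↭ (k ∣?_) (sortDesc-↭ (replicate r v ++ rest))) (↭-reflexive (begin
    filter (k ∣?_) (replicate r v ++ rest)                  ≡⟨ filter-++ (k ∣?_) (replicate r v) rest ⟩
    filter (k ∣?_) (replicate r v) ++ filter (k ∣?_) rest   ≡⟨ cong₂ _++_ (filter-all (k ∣?_) (All.replicate⁺ r k∣v))
                                                                           (filter-none (k ∣?_) (All-removeN (r * k ^ suc j) i lam-indivisible)) ⟩
    replicate r v ++ []                                     ≡⟨ ++-identityʳ (replicate r v) ⟩
    replicate r v                                           ∎))
    where
    open ≡-Reasoning
    v : ℕ
    v = i * k ^ suc j
    rest : List ℕ
    rest = removeN (r * k ^ suc j) i lam
    k∣v : k ∣ v
    k∣v = ∣-trans (m∣m*n (k ^ j)) (n∣m*n i)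

  piPart-injectiveʳ : ∀ j {r r′} → piPart k lam i (suc j) r ≡ piPart k lam i (suc j) r′ → r ≡ r′
  piPart-injectiveʳ j {r} {r′} eq = begin
    r                                                   ≡⟨ length-replicate r ⟨
    length (replicate r (i * k ^ suc j))                ≡⟨ ↭-length (filter-∣-piPart j r) ⟨
    length (filter (k ∣?_) (piPart k lam i (suc j) r))  ≡⟨ cong (length ∘ filter (k ∣?_)) eq ⟩
    length (filter (k ∣?_) (piPart k lam i (suc j) r′)) ≡⟨ ↭-length (filter-∣-piPart j r′) ⟩
    length (replicate r′ (i * k ^ suc j))               ≡⟨ length-replicate r′ ⟩
    r′                                                  ∎
    where open ≡-Reasoning

  -- i·k^(1+a) is a part of the left side divisible by k, so it is one of the r′ copies of i·k^(1+b).
  piPart-injectiveˡ : 1 < k → 0 < i → ∀ a b r {r′} →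
    piPart k lam i (suc a) (suc r) ≡ piPart k lam i (suc b) r′ → a ≡ b
  piPart-injectiveˡ 1<k 0<i a b r {r′} eq =
    suc-injective (^-injectiveʳ 1<k (*-cancelˡ-≡ _ _ i {{>-nonZero 0<i}} (All.lookup parts≡ part∈)))
    where
    parts≡ : All (_≡ i * k ^ suc b) (replicate r′ (i * k ^ suc b))
    parts≡ = All.replicate⁺ r′ refl
    part∈ : i * k ^ suc a ∈ replicate r′ (i * k ^ suc b)
    part∈ = ∈-resp-↭ (filter-∣-piPart b r′)
      (subst (λ π → i * k ^ suc a ∈ filter (k ∣?_) π) eq (∈-resp-↭ (↭-sym (filter-∣-piPart a (suc r))) (here refl)))

module _ {k : ℕ} (1<k : 1 < k) where

  private instance
    k≢0 : NonZero k
    k≢0 = >-nonZero (<-trans z<s 1<k)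

  -- The base-k digits of m are m % k followed by those of q = m / k, here computed with fuel f.
  legendre-digitsF : ∀ f q m → q ≤ f → m / k ≡ q →
    (k ∸ 1) * quotientSum k m (length (digitsF k f q)) + (m % k + sum (digitsF k f q)) ≡ m
  legendre-digitsF f zero m _ m/k≡0 = begin
    (k ∸ 1) * quotientSum k m (length (digitsF k f 0)) + (m % k + sum (digitsF k f 0))
      ≡⟨ cong (λ ds → (k ∸ 1) * quotientSum k m (length ds) + (m % k + sum ds)) (digitsF-zero k f) ⟩
    (k ∸ 1) * 0 + (m % k + 0)  ≡⟨ cong (_+ (m % k + 0)) (*-zeroʳ (k ∸ 1)) ⟩
    m % k + 0 * k              ≡⟨ cong (λ q → m % k + q * k) m/k≡0 ⟨
    m % k + m / k * k          ≡⟨ m≡m%n+[m/n]*n m k ⟨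
    m                          ∎
    where open ≡-Reasoning
  legendre-digitsF zero    (suc q) m () _
  legendre-digitsF (suc f) (suc q) m (s≤s q≤f) m/k≡1+q rewrite digitsF-suc k f q = begin
    (k ∸ 1) * quotientSum k m (suc len) + (m % k + rest)
      ≡⟨ cong (λ s → (k ∸ 1) * s + (m % k + rest)) (quotientSum-suc k m len) ⟩
    (k ∸ 1) * (m / k + quotientSum k (m / k) len) + (m % k + rest)
      ≡⟨ cong (λ q → (k ∸ 1) * (q + quotientSum k q len) + (m % k + rest)) m/k≡1+q ⟩
    (k ∸ 1) * (suc q + quotientSum k (suc q) len) + (m % k + rest)
      ≡⟨ carry (k ∸ 1) (quotientSum k (suc q) len) (m % k) rest (suc q) ih ⟩
    m % k + suc q * suc (k ∸ 1)  ≡⟨ cong (λ s → m % k + suc q * s) (suc-pred k) ⟩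
    m % k + suc q * k            ≡⟨ cong (λ q → m % k + q * k) m/k≡1+q ⟨
    m % k + m / k * k            ≡⟨ m≡m%n+[m/n]*n m k ⟨
    m                            ∎
    where
    open ≡-Reasoning
    len : ℕ
    len = length (digitsF k f (suc q / k))
    rest : ℕ
    rest = suc q % k + sum (digitsF k f (suc q / k))
    ih : (k ∸ 1) * quotientSum k (suc q) len + rest ≡ suc q
    ih = legendre-digitsF f (suc q / k) (suc q) (≤-trans (s≤s⁻¹ (m/n<m (suc q) k 1<k)) q≤f) refl
    carry : ∀ c D r t Q → c * D + t ≡ Q → c * (Q + D) + (r + t) ≡ r + Q * suc c
    carry c D r t .(c * D + t) refl = identity c D r t
      where
      identity : ∀ c D r t → c * ((c * D + t) + D) + (r + t) ≡ r + (c * D + t) * suc c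
      identity = solve-∀

  legendre : ∀ m → (k ∸ 1) * quotientSum k m (ak k m) + pk k m ≡ m
  legendre zero rewrite digitsF-zero k 0 = trans (+-identityʳ ((k ∸ 1) * 0)) (*-zeroʳ (k ∸ 1))
  legendre (suc m) rewrite digitsF-suc k m m =
    legendre-digitsF m (suc m / k) (suc m) (s≤s⁻¹ (m/n<m (suc m) k 1<k)) refl

  module _ {lam : List ℕ} {i : ℕ} (lam-indivisible : All (λ a → ¬ k ∣ a) lam) (0<i : 0 < i) where

    private
      M : ℕ
      M = mult i lam

      admissible : ℕ → List ℕ
      admissible j = filter (λ r → r * k ^ j ≤? M) (applyUpTo suc M)

      block : ℕ → List (List ℕ)
      block j = map (piPart k lam i j) (admissible j)

      length-block : ∀ j → length (block j) ≡ ⌊ M / k ^ j ⌋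
      length-block j = trans (length-map (piPart k lam i j) (admissible j))
        (length-filter-applyUpTo-suc (λ r → r * k ^ j ≤? M)
          (*≤⇒≤/ _ M (k ^ j) {{m^n≢0 k j}}) (≤/⇒*≤ _ M (k ^ j) {{m^n≢0 k j}}) (m/n≤m M (k ^ j) {{m^n≢0 k j}}))

      block-unique : ∀ j → Unique (block (suc j))
      block-unique j = Unique.map⁺ (piPart-injectiveʳ lam-indivisible j)
        (Unique.filter⁺ (λ r → r * k ^ suc j ≤? M) (applyUpTo-suc-unique M))

      blocks-disjoint : ∀ {a b} → a < b → Disjoint (block (suc a)) (block (suc b))
      blocks-disjoint {a} {b} a<b (π∈a , π∈b)
        with r , r∈ , refl ← ∈-map⁻ (piPart k lam i (suc a)) π∈a
        with r′ , _ , π≡ ← ∈-map⁻ (piPart k lam i (suc b)) π∈b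
        with r₀ , _ , refl ← ∈-applyUpTo⁻ suc {n = M} (proj₁ (∈-filter⁻ (λ r → r * k ^ suc a ≤? M) r∈))
        = <⇒≢ a<b (piPart-injectiveˡ lam-indivisible 1<k 0<i a b r₀ {r′} π≡)

      piList-unique : Unique (piList k lam i)
      piList-unique = Unique.concat⁺
        (All.map⁺ (All.applyUpTo⁺₁ suc (ak k M) (λ {j} _ → block-unique j)))
        (AllPairs.map⁺ (AllPairs.applyUpTo⁺₁ suc (ak k M) (λ a<b _ → blocks-disjoint a<b)))

    length-Oset : length (Oset k lam i) ≡ quotientSum k (mult i lam) (ak k (mult i lam))
    length-Oset = begin
      length (Oset k lam i)                    ≡⟨ cong length (deduplicate-unique (≡-dec _≟_) piList-unique) ⟩
      length (piList k lam i)                  ≡⟨ length-concatMap block js ⟩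
      sum (map (λ j → length (block j)) js)    ≡⟨ cong sum (map-cong length-block js) ⟩
      sum (map (λ j → ⌊ M / k ^ j ⌋) js)       ∎
      where
      open ≡-Reasoning
      js : List ℕ
      js = applyUpTo suc (ak k M)

lemma3p2 : (k n : ℕ) → 2 ≤ k → (lam : List ℕ) → InO k n lam →
    (i : ℕ) → i ∈ lam →
    (k ∸ 1) * length (Oset k lam i) + pk k (mult i lam) ≡ mult i lam
lemma3p2 k n 2≤k lam ((_ , parts-positive , _) , parts-indivisible) i i∈lam = begin
  (k ∸ 1) * length (Oset k lam i) + pk k m                ≡⟨ cong (λ s → (k ∸ 1) * s + pk k m) |𝒪| ⟩
  (k ∸ 1) * quotientSum k m (ak k m) + pk k m             ≡⟨ legendre 2≤k m ⟩
  m                                                       ∎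
  where
  open ≡-Reasoning
  m : ℕ
  m = mult i lam
  instance
    k≢0 : NonZero k
    k≢0 = >-nonZero (<-trans z<s 2≤k)
  |𝒪| : length (Oset k lam i) ≡ quotientSum k m (ak k m)
  |𝒪| = length-Oset 2≤k parts-indivisible (All.lookup parts-positive i∈lam)
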